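{- Let $n\ge 2$ and let $X_1, X_2, X_3$ be the three parts of $K_{n,n,n}$. On the set $\mathcal{X} = E(K_{n,n,n})$ define relations $R_0,\dots,R_4$ as follows: $(e,f)\in R_0$ if $e=f$; $(e,f) \in R_1$ if $e \ne f$, $e$ and $f$ join the same pair of parts, and they share a vertex; $(e,f)\in R_2$ if $e$ and $f$ join the same pair of parts and are disjoint; $(e,f)\in R_3$ if $e,f$ join different pairs of parts and share a vertex; $(e,f)\in R_4$ if $e,f$ join different pairs of parts and are disjoint. Then $(\mathcal{X}; R_0,\dots,R_4)$ is a symmetric $4$-class association scheme.
   Context: A symmetric $k$-class association scheme on a finite set $\mathcal{X}$ consists of $k+1$ nonempty symmetric binary relations $R_0,\dots,R_k$ partitioning $\mathcal{X}\times\mathcal{X}$ such that $R_0$ is the identity relation, and for all $h,i,j$ and every $(x,y)\in R_h$ the number of $z\in\mathcal{X}$ with $(x,z)\in R_i$ and $(z,y)\in R_j$ is a constant $a^h_{ij}$ depending only on $h,i,j$. (Equivalently, the set of edges of $K_{n,n,n}$ is the second level of the Hamming lattice $([n]\cup\{*\})^3$, i.e. words with exactly two non-$*$ coordinates.) -}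

module Defs where

open import Data.Nat using (ℕ; suc; _≥_)
open import Data.Fin using (Fin; zero; suc; _≟_)
open import Data.Fin.Properties using (all?)
open import Data.Product using (Σ; _×_; _,_; ∃; ∃-syntax)
open import Data.Product.Properties using (≡-dec)
open import Data.Sum using (_⊎_)
open import Data.List using (List; length; filter; allFin; cartesianProduct; map; concatMap)
open import Relation.Nullary using (Dec; ¬_; yes; no)
open import Relation.Nullary.Decidable using (_×-dec_; _⊎-dec_; ¬?)
open import Relation.Binary.PropositionalEquality using (_≡_)
open import Function.Bundles using (_⇔_)

-- X is given together with an enumeration `enum` listing every element
-- exactly once (the one used below is allEdges, which does so).

module _ {X : Set} (enum : List X) where

  count : (P : X → Set) → (∀ z → Dec (P z)) → ℕ
  count P P? = length (filter P? enum)

  record IsSymAssocScheme (k : ℕ) (R : Fin (suc k) → X → X → Set)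
           (R? : ∀ i x y → Dec (R i x y)) : Set where
    field
      partition  : ∀ x y → Σ (Fin (suc k)) λ i → R i x y × (∀ j → R j x y → j ≡ i)
      nonempty   : ∀ i → ∃[ x ] ∃[ y ] R i x y
      identity   : ∀ x y → R zero x y ⇔ x ≡ y
      symmetric  : ∀ i x y → R i x y → R i y x
      intersection :
        Σ (Fin (suc k) → Fin (suc k) → Fin (suc k) → ℕ) λ a →
          ∀ h i j x y → R h x y →
            count (λ z → R i x z × R j z y) (λ z → R? i x z ×-dec R? j z y) ≡ a h i j

Vertex : ℕ → Set
Vertex n = Fin 3 × Fin n

-- An edge is determined by the part m it avoids and its two endpoints,
-- one in each of the other two parts (in increasing order of part):
-- (m , a , b) joins (lo m , a) and (hi m , b).
Edge : ℕ → Set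
Edge n = Fin 3 × Fin n × Fin n

lo hi : Fin 3 → Fin 3
lo zero = suc zero
lo (suc _) = zero
hi zero = suc (suc zero)
hi (suc zero) = suc (suc zero)
hi (suc (suc zero)) = suc zero

end₁ end₂ : ∀ {n} → Edge n → Vertex n
end₁ (m , a , b) = lo m , a
end₂ (m , a , b) = hi m , b

allEdges : (n : ℕ) → List (Edge n)
allEdges n = cartesianProduct (allFin 3) (cartesianProduct (allFin n) (allFin n))

samePair : ∀ {n} → Edge n → Edge n → Set
samePair (m , _) (m' , _) = m ≡ m'

_∈ₑ_ : ∀ {n} → Vertex n → Edge n → Set
v ∈ₑ e = (v ≡ end₁ e) ⊎ (v ≡ end₂ e)

share : ∀ {n} → Edge n → Edge n → Set
share e f = ∃[ v ] (v ∈ₑ e × v ∈ₑ f)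

R : ∀ {n} → Fin 5 → Edge n → Edge n → Set
R zero e f = e ≡ f
R (suc zero) e f = ¬ (e ≡ f) × samePair e f × share e f
R (suc (suc zero)) e f = samePair e f × ¬ share e f
R (suc (suc (suc zero))) e f = ¬ samePair e f × share e f
R (suc (suc (suc (suc zero)))) e f = ¬ samePair e f × ¬ share e f

vertex? : ∀ {n} (u v : Vertex n) → Dec (u ≡ v)
vertex? = ≡-dec _≟_ _≟_

edge? : ∀ {n} (e f : Edge n) → Dec (e ≡ f)
edge? = ≡-dec _≟_ (≡-dec _≟_ _≟_)

samePair? : ∀ {n} (e f : Edge n) → Dec (samePair e f)
samePair? (m , _) (m' , _) = m ≟ m'

share? : ∀ {n} (e f : Edge n) → Dec (share e f)
share? e f with vertex? (end₁ e) (end₁ f) | vertex? (end₁ e) (end₂ f)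
              | vertex? (end₂ e) (end₁ f) | vertex? (end₂ e) (end₂ f)
... | yes p | _ | _ | _ = yes (end₁ e , Data.Sum.inj₁ _≡_.refl , Data.Sum.inj₁ p)
... | no _ | yes p | _ | _ = yes (end₁ e , Data.Sum.inj₁ _≡_.refl , Data.Sum.inj₂ p)
... | no _ | no _ | yes p | _ = yes (end₂ e , Data.Sum.inj₂ _≡_.refl , Data.Sum.inj₁ p)
... | no _ | no _ | no _ | yes p = yes (end₂ e , Data.Sum.inj₂ _≡_.refl , Data.Sum.inj₂ p)
... | no a | no b | no c | no d = no λ where
  (v , Data.Sum.inj₁ _≡_.refl , Data.Sum.inj₁ q) → a q
  (v , Data.Sum.inj₁ _≡_.refl , Data.Sum.inj₂ q) → b q
  (v , Data.Sum.inj₂ _≡_.refl , Data.Sum.inj₁ q) → c q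
  (v , Data.Sum.inj₂ _≡_.refl , Data.Sum.inj₂ q) → d q

R? : ∀ {n} i (e f : Edge n) → Dec (R i e f)
R? zero e f = edge? e f
R? (suc zero) e f = ¬? (edge? e f) ×-dec samePair? e f ×-dec share? e f
R? (suc (suc zero)) e f = samePair? e f ×-dec ¬? (share? e f)
R? (suc (suc (suc zero))) e f = ¬? (samePair? e f) ×-dec share? e f
R? (suc (suc (suc (suc zero)))) e f = ¬? (samePair? e f) ×-dec ¬? (share? e f)

-- The relations are the orbitals of the automorphism group of K_{n,n,n}
-- acting on its edges: relabelling the vertices inside each part and swapping
-- two parts are automorphisms, and they already act transitively on each R h.
-- The number of z with R i x z and R j z y is invariant under automorphisms,
-- so for (x , y) ∈ R h it only depends on h.
module Submission where

open import Defs
open import Data.Empty using (⊥-elim)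
open import Data.Fin using (Fin; suc; _≟_)
open import Data.Fin.Patterns using (0F; 1F; 2F; 3F; 4F)
open import Data.Fin.Permutation using (Permutation′; _⟨$⟩ʳ_; inverseˡ; inverseʳ; flip; transpose; id)
open import Data.List using (List; []; _∷_; length; filter; map)
open import Data.List.Membership.Propositional using (_∈_)
open import Data.List.Membership.Propositional.Properties using (∈-map⁺; ∈-allFin; ∈-cartesianProduct⁺)
open import Data.List.Membership.Propositional.Properties.WithK using (unique∧set⇒bag)
open import Data.List.Properties using (filter-≐)
open import Data.List.Relation.Binary.BagAndSetEquality using (∼bag⇒↭)
open import Data.List.Relation.Binary.Permutation.Propositional using (_↭_)
open import Data.List.Relation.Binary.Permutation.Propositional.Properties using (filter-↭; ↭-length)
open import Data.List.Relation.Unary.Unique.Propositional using (Unique)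
open import Data.List.Relation.Unary.Unique.Propositional.Properties using (map⁺; allFin⁺; cartesianProduct⁺)
open import Data.Nat using (ℕ; suc; 2+; _≥_; s≤s)
open import Data.Product using (Σ; _×_; _,_; -,_; ∃; proj₁; proj₂; uncurry)
open import Data.Product.Function.NonDependent.Propositional using (_×-⇔_)
open import Data.Sum using (inj₁; inj₂)
open import Function using (_∘_)
open import Function.Bundles using (_⇔_; mk⇔; Equivalence; _↔_; Inverse; Injection; mk↔ₛ′)
open import Function.Properties.Inverse using (↔⇒↣)
open import Function.Construct.Identity using (⇔-id)
open import Function.Construct.Symmetry using (↔-sym)
open import Level using (0ℓ)
open import Relation.Binary.Construct.Closure.ReflexiveTransitive using (Star; ε; _◅_; _◅◅_)
open import Relation.Binary.PropositionalEquality using (_≡_; refl; sym; trans; cong; cong₂; subst₂; module ≡-Reasoning)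
open import Relation.Nullary using (Dec; yes; no)
open import Relation.Nullary.Decidable using (_×-dec_; dec-true; from-yes; from-no)
open import Relation.Unary using (Pred; Decidable; _≐_)

module _ {A B : Set} {P : Pred B 0ℓ} (P? : Decidable P) (f : A → B) where

  length-filter-map : ∀ xs → length (filter P? (map f xs)) ≡ length (filter (P? ∘ f) xs)
  length-filter-map [] = refl
  length-filter-map (x ∷ xs) with P? (f x)
  ... | yes _ = cong suc (length-filter-map xs)
  ... | no _ = length-filter-map xs

transpose-maps : ∀ {n} (i j : Fin n) → transpose i j ⟨$⟩ʳ i ≡ j
transpose-maps i j rewrite dec-true (i ≟ i) refl = refl

module _ {X : Set} (enum : List X) (enum-unique : Unique enum) (enum-complete : ∀ x → x ∈ enum) where

  map-↔-↭ : (σ : X ↔ X) → map (Inverse.to σ) enum ↭ enum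
  map-↔-↭ σ = ∼bag⇒↭ (unique∧set⇒bag (map⁺ (Injection.injective (↔⇒↣ σ)) enum-unique) enum-unique
                                    (λ {y} → mk⇔ (λ _ → enum-complete y) (λ _ → image y)))
    where
    open Inverse σ
    image : ∀ y → y ∈ map to enum
    image y = subst₂ _∈_ (strictlyInverseˡ y) refl (∈-map⁺ to (enum-complete (from y)))

  count-↔ : (σ : X ↔ X) {P Q : Pred X 0ℓ} (P? : Decidable P) (Q? : Decidable Q) →
            (∀ z → P z ⇔ Q (Inverse.to σ z)) → count enum P P? ≡ count enum Q Q?
  count-↔ σ {P} {Q} P? Q? P⇔Q∘σ = begin
    length (filter P? enum)          ≡⟨ cong length (filter-≐ P? (Q? ∘ to) P≐Q∘σ enum) ⟩
    length (filter (Q? ∘ to) enum)   ≡⟨ sym (length-filter-map Q? to enum) ⟩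
    length (filter Q? (map to enum)) ≡⟨ ↭-length (filter-↭ Q? (map-↔-↭ σ)) ⟩
    length (filter Q? enum)          ∎
    where
    open Inverse σ using (to)
    open ≡-Reasoning
    P≐Q∘σ : P ≐ (Q ∘ to)
    P≐Q∘σ = (λ {z} → Equivalence.to (P⇔Q∘σ z)) , (λ {z} → Equivalence.from (P⇔Q∘σ z))

  module OrbitalScheme {k : ℕ} (R : Fin (suc k) → X → X → Set) (R? : ∀ i x y → Dec (R i x y)) where

    record Automorphism : Set where
      field
        permutation : X ↔ X
      open Inverse permutation public using (to)
      field
        preserves : ∀ i x y → R i x y ⇔ R i (to x) (to y)

    intersectionCount : Fin (suc k) → Fin (suc k) → X → X → ℕ
    intersectionCount i j x y = count enum (λ z → R i x z × R j z y) (λ z → R? i x z ×-dec R? j z y)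

    intersectionCount-invariant : (σ : Automorphism) → let open Automorphism σ in
      ∀ i j x y → intersectionCount i j x y ≡ intersectionCount i j (to x) (to y)
    intersectionCount-invariant σ i j x y =
      count-↔ permutation _ _ λ z → preserves i x z ×-⇔ preserves j z y
      where open Automorphism σ

    _⟶_ : X × X → X × X → Set
    (x , y) ⟶ (x′ , y′) = Σ Automorphism λ σ → Automorphism.to σ x ≡ x′ × Automorphism.to σ y ≡ y′

    _∼_ : X × X → X × X → Set
    _∼_ = Star _⟶_

    ∼-intersectionCount : ∀ {x y x′ y′} → (x , y) ∼ (x′ , y′) → ∀ i j →
                          intersectionCount i j x y ≡ intersectionCount i j x′ y′
    ∼-intersectionCount ε i j = refl
    ∼-intersectionCount ((σ , refl , refl) ◅ orbit) i j =
      trans (intersectionCount-invariant σ i j _ _) (∼-intersectionCount orbit i j)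

    ∼-preserves-R : ∀ {h x y x′ y′} → (x , y) ∼ (x′ , y′) → R h x y → R h x′ y′
    ∼-preserves-R ε r = r
    ∼-preserves-R {h} ((σ , refl , refl) ◅ orbit) r =
      ∼-preserves-R orbit (Equivalence.to (Automorphism.preserves σ h _ _) r)

    OrbitRepresentatives : (Fin (suc k) → X × X) → Set
    OrbitRepresentatives rep = ∀ h x y → R h x y → (x , y) ∼ rep h

    intersectionNumbers : (rep : Fin (suc k) → X × X) → OrbitRepresentatives rep →
      Σ (Fin (suc k) → Fin (suc k) → Fin (suc k) → ℕ) λ a →
        ∀ h i j x y → R h x y → intersectionCount i j x y ≡ a h i j
    intersectionNumbers rep orbit =
      (λ h i j → uncurry (intersectionCount i j) (rep h)) ,
      λ h i j x y r → ∼-intersectionCount (orbit h x y r) i j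

allEdges-unique : ∀ n → Unique (allEdges n)
allEdges-unique n = cartesianProduct⁺ (allFin⁺ 3) (cartesianProduct⁺ (allFin⁺ n) (allFin⁺ n))

allEdges-complete : ∀ n (e : Edge n) → e ∈ allEdges n
allEdges-complete n (m , a , b) = ∈-cartesianProduct⁺ (∈-allFin m) (∈-cartesianProduct⁺ (∈-allFin a) (∈-allFin b))

module EdgeScheme (n : ℕ) = OrbitalScheme (allEdges n) (allEdges-unique n) (allEdges-complete n) (R {n}) R?

module _ {n : ℕ} where
  open EdgeScheme n

  record PreservesStructure (f : Edge n → Edge n) : Set where
    field
      samePair-preserved : ∀ {e g} → samePair e g → samePair (f e) (f g)
      share-preserved    : ∀ {e g} → share e g → share (f e) (f g)

  share-refl : (e : Edge n) → share e e
  share-refl (m , a , b) = -, inj₁ refl , inj₁ refl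

  share-sym : {e f : Edge n} → share e f → share f e
  share-sym (v , v∈e , v∈f) = v , v∈f , v∈e

  share-preserved-by-incidence : {f : Edge n → Edge n} (φ : Vertex n → Vertex n) →
    (∀ {v e} → v ∈ₑ e → φ v ∈ₑ f e) → ∀ {e g} → share e g → share (f e) (f g)
  share-preserved-by-incidence φ incidence (v , v∈e , v∈g) = φ v , incidence v∈e , incidence v∈g

  module _ (σ : Edge n ↔ Edge n) (to-preserves : PreservesStructure (Inverse.to σ))
           (from-preserves : PreservesStructure (Inverse.from σ)) where
    open Inverse σ
    open PreservesStructure

    samePair-reflected : ∀ {e g} → samePair (to e) (to g) → samePair e g
    samePair-reflected {e} {g} sp =
      subst₂ samePair (strictlyInverseʳ e) (strictlyInverseʳ g) (samePair-preserved from-preserves sp)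

    share-reflected : ∀ {e g} → share (to e) (to g) → share e g
    share-reflected {e} {g} sh =
      subst₂ share (strictlyInverseʳ e) (strictlyInverseʳ g) (share-preserved from-preserves sh)

    R-preserved : ∀ i {e g} → R i e g → R i (to e) (to g)
    R-preserved 0F refl = refl
    R-preserved 1F (e≢g , sp , sh) =
      e≢g ∘ Injection.injective (↔⇒↣ σ) , samePair-preserved to-preserves sp , share-preserved to-preserves sh
    R-preserved 2F (sp , ¬sh) = samePair-preserved to-preserves sp , ¬sh ∘ share-reflected
    R-preserved 3F (¬sp , sh) = ¬sp ∘ samePair-reflected , share-preserved to-preserves sh
    R-preserved 4F (¬sp , ¬sh) = ¬sp ∘ samePair-reflected , ¬sh ∘ share-reflected

  edgeAutomorphism : (σ : Edge n ↔ Edge n) → PreservesStructure (Inverse.to σ) →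
                     PreservesStructure (Inverse.from σ) → Automorphism
  edgeAutomorphism σ to-preserves from-preserves = record
    { permutation = σ
    ; preserves = λ i x y → mk⇔ (R-preserved σ to-preserves from-preserves i)
        (subst₂ (R i) (strictlyInverseʳ x) (strictlyInverseʳ y) ∘ R-preserved (↔-sym σ) from-preserves to-preserves i)
    }
    where open Inverse σ

  involutiveAutomorphism : (f : Edge n → Edge n) → (∀ e → f (f e) ≡ e) → PreservesStructure f → Automorphism
  involutiveAutomorphism f f-involutive f-preserves =
    edgeAutomorphism (mk↔ₛ′ f f f-involutive f-involutive) f-preserves f-preserves

  relabelEdge : (Fin 3 → Permutation′ n) → Edge n → Edge n
  relabelEdge π (m , a , b) = m , π (lo m) ⟨$⟩ʳ a , π (hi m) ⟨$⟩ʳ b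

  relabelEdge-preserves : (π : Fin 3 → Permutation′ n) → PreservesStructure (relabelEdge π)
  relabelEdge-preserves π = record
    { samePair-preserved = λ { {_ , _} {_ , _} sp → sp }
    ; share-preserved = share-preserved-by-incidence (λ (q , c) → q , π q ⟨$⟩ʳ c) incidence
    }
    where
    incidence : ∀ {v e} → v ∈ₑ e → (proj₁ v , π (proj₁ v) ⟨$⟩ʳ proj₂ v) ∈ₑ relabelEdge π e
    incidence {e = _ , _ , _} (inj₁ refl) = inj₁ refl
    incidence {e = _ , _ , _} (inj₂ refl) = inj₂ refl

  relabel : (π₀ π₁ π₂ : Permutation′ n) → Automorphism
  relabel π₀ π₁ π₂ = edgeAutomorphism
    (mk↔ₛ′ (relabelEdge π) (relabelEdge (flip ∘ π)) inverseˡ′ inverseʳ′)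
    (relabelEdge-preserves π) (relabelEdge-preserves (flip ∘ π))
    where
    π : Fin 3 → Permutation′ n
    π 0F = π₀
    π 1F = π₁
    π 2F = π₂
    inverseˡ′ : ∀ e → relabelEdge π (relabelEdge (flip ∘ π) e) ≡ e
    inverseˡ′ (m , a , b) = cong₂ (λ a′ b′ → m , a′ , b′) (inverseʳ (π (lo m))) (inverseʳ (π (hi m)))
    inverseʳ′ : ∀ e → relabelEdge (flip ∘ π) (relabelEdge π e) ≡ e
    inverseʳ′ (m , a , b) = cong₂ (λ a′ b′ → m , a′ , b′) (inverseˡ (π (lo m))) (inverseˡ (π (hi m)))

  swapParts₀₁ : Edge n → Edge n
  swapParts₀₁ (0F , a , b) = 1F , a , b
  swapParts₀₁ (1F , a , b) = 0F , a , b
  swapParts₀₁ (2F , a , b) = 2F , b , a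

  swap₀₁ : Automorphism
  swap₀₁ = involutiveAutomorphism swapParts₀₁ involutive record
    { samePair-preserved = λ { {0F , _} {_ , _} refl → refl ; {1F , _} {_ , _} refl → refl ; {2F , _} {_ , _} refl → refl }
    ; share-preserved = share-preserved-by-incidence (λ (q , c) → τ q , c) incidence
    }
    where
    involutive : ∀ e → swapParts₀₁ (swapParts₀₁ e) ≡ e
    involutive (0F , _) = refl
    involutive (1F , _) = refl
    involutive (2F , _) = refl
    τ : Fin 3 → Fin 3
    τ 0F = 1F
    τ 1F = 0F
    τ 2F = 2F
    incidence : ∀ {v e} → v ∈ₑ e → (τ (proj₁ v) , proj₂ v) ∈ₑ swapParts₀₁ e
    incidence {e = 0F , _} (inj₁ refl) = inj₁ refl
    incidence {e = 0F , _} (inj₂ refl) = inj₂ refl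
    incidence {e = 1F , _} (inj₁ refl) = inj₁ refl
    incidence {e = 1F , _} (inj₂ refl) = inj₂ refl
    incidence {e = 2F , _} (inj₁ refl) = inj₂ refl
    incidence {e = 2F , _} (inj₂ refl) = inj₁ refl

  swapParts₁₂ : Edge n → Edge n
  swapParts₁₂ (0F , a , b) = 0F , b , a
  swapParts₁₂ (1F , a , b) = 2F , a , b
  swapParts₁₂ (2F , a , b) = 1F , a , b

  swap₁₂ : Automorphism
  swap₁₂ = involutiveAutomorphism swapParts₁₂ involutive record
    { samePair-preserved = λ { {0F , _} {_ , _} refl → refl ; {1F , _} {_ , _} refl → refl ; {2F , _} {_ , _} refl → refl }
    ; share-preserved = share-preserved-by-incidence (λ (q , c) → τ q , c) incidence
    }
    where
    involutive : ∀ e → swapParts₁₂ (swapParts₁₂ e) ≡ e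
    involutive (0F , _) = refl
    involutive (1F , _) = refl
    involutive (2F , _) = refl
    τ : Fin 3 → Fin 3
    τ 0F = 0F
    τ 1F = 2F
    τ 2F = 1F
    incidence : ∀ {v e} → v ∈ₑ e → (τ (proj₁ v) , proj₂ v) ∈ₑ swapParts₁₂ e
    incidence {e = 0F , _} (inj₁ refl) = inj₂ refl
    incidence {e = 0F , _} (inj₂ refl) = inj₁ refl
    incidence {e = 1F , _} (inj₁ refl) = inj₁ refl
    incidence {e = 1F , _} (inj₂ refl) = inj₂ refl
    incidence {e = 2F , _} (inj₁ refl) = inj₁ refl
    incidence {e = 2F , _} (inj₂ refl) = inj₂ refl

  relationOf : {e f : Edge n} → Dec (e ≡ f) → Dec (samePair e f) → Dec (share e f) → Fin 5
  relationOf (yes _) _       _       = 0F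
  relationOf (no _)  (yes _) (yes _) = 1F
  relationOf (no _)  (yes _) (no _)  = 2F
  relationOf (no _)  (no _)  (yes _) = 3F
  relationOf (no _)  (no _)  (no _)  = 4F

  R-relationOf : {e f : Edge n} → ∀ d₁ d₂ d₃ → R (relationOf {e} {f} d₁ d₂ d₃) e f
  R-relationOf (yes e≡f) _        _        = e≡f
  R-relationOf (no e≢f)  (yes sp) (yes sh) = e≢f , sp , sh
  R-relationOf (no _)    (yes sp) (no ¬sh) = sp , ¬sh
  R-relationOf (no _)    (no ¬sp) (yes sh) = ¬sp , sh
  R-relationOf (no _)    (no ¬sp) (no ¬sh) = ¬sp , ¬sh

  relationOf-unique : ∀ i {e f : Edge n} d₁ d₂ d₃ → R i e f → relationOf {e} {f} d₁ d₂ d₃ ≡ i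
  relationOf-unique 0F (yes _)   _        _        _                = refl
  relationOf-unique 0F (no e≢e)  _        _        refl             = ⊥-elim (e≢e refl)
  relationOf-unique 1F (yes e≡f) _        _        (e≢f , _)        = ⊥-elim (e≢f e≡f)
  relationOf-unique 1F (no _)    (yes _)  (yes _)  _                = refl
  relationOf-unique 1F (no _)    (yes _)  (no ¬sh) (_ , _ , sh)     = ⊥-elim (¬sh sh)
  relationOf-unique 1F (no _)    (no ¬sp) _        (_ , sp , _)     = ⊥-elim (¬sp sp)
  relationOf-unique 2F {e} (yes refl) _   _        (_ , ¬sh)        = ⊥-elim (¬sh (share-refl e))
  relationOf-unique 2F (no _)    (yes _)  (yes sh) (_ , ¬sh)        = ⊥-elim (¬sh sh)
  relationOf-unique 2F (no _)    (yes _)  (no _)   _                = refl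
  relationOf-unique 2F (no _)    (no ¬sp) _        (sp , _)         = ⊥-elim (¬sp sp)
  relationOf-unique 3F (yes refl) _       _        (¬sp , _)        = ⊥-elim (¬sp refl)
  relationOf-unique 3F (no _)    (yes sp) _        (¬sp , _)        = ⊥-elim (¬sp sp)
  relationOf-unique 3F (no _)    (no _)   (yes _)  _                = refl
  relationOf-unique 3F (no _)    (no _)   (no ¬sh) (_ , sh)         = ⊥-elim (¬sh sh)
  relationOf-unique 4F (yes refl) _       _        (¬sp , _)        = ⊥-elim (¬sp refl)
  relationOf-unique 4F (no _)    (yes sp) _        (¬sp , _)        = ⊥-elim (¬sp sp)
  relationOf-unique 4F (no _)    (no _)   (yes sh) (_ , ¬sh)        = ⊥-elim (¬sh sh)
  relationOf-unique 4F (no _)    (no _)   (no _)   _                = refl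

  relation : Edge n → Edge n → Fin 5
  relation e f = relationOf (edge? e f) (samePair? e f) (share? e f)

  R-relation : ∀ e f → R (relation e f) e f
  R-relation e f = R-relationOf (edge? e f) (samePair? e f) (share? e f)

  R⇒relation : ∀ i {e f} → R i e f → relation e f ≡ i
  R⇒relation i {e} {f} = relationOf-unique i (edge? e f) (samePair? e f) (share? e f)

  R-symmetric : ∀ i (e f : Edge n) → R i e f → R i f e
  R-symmetric 0F e f e≡f = sym e≡f
  R-symmetric 1F e f (e≢f , sp , sh) = e≢f ∘ sym , sym sp , share-sym sh
  R-symmetric 2F e f (sp , ¬sh) = sym sp , ¬sh ∘ share-sym
  R-symmetric 3F e f (¬sp , sh) = ¬sp ∘ sym , share-sym sh
  R-symmetric 4F e f (¬sp , ¬sh) = ¬sp ∘ sym , ¬sh ∘ share-sym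

module _ {k : ℕ} where
  open EdgeScheme (2+ k)

  origin : Edge (2+ k)
  origin = 0F , 0F , 0F

  representative : Fin 5 → Edge (2+ k)
  representative 0F = origin
  representative 1F = 0F , 0F , 1F
  representative 2F = 0F , 1F , 1F
  representative 3F = 1F , 0F , 0F
  representative 4F = 1F , 0F , 1F

  R-representative : ∀ h → R h origin (representative h)
  R-representative 0F = refl
  R-representative 1F = from-yes (R? 1F origin (representative 1F))
  R-representative 2F = from-yes (R? 2F origin (representative 2F))
  R-representative 3F = from-yes (R? 3F origin (representative 3F))
  R-representative 4F = from-yes (R? 4F origin (representative 4F))

  moveToOrigin₀ : ∀ a b y → ∃ λ y′ → ((0F , a , b) , y) ∼ (origin , y′)
  moveToOrigin₀ a b y =
    -, (relabel id (transpose a 0F) (transpose b 0F) ,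
        cong₂ (λ a′ b′ → 0F , a′ , b′) (transpose-maps a 0F) (transpose-maps b 0F) , refl) ◅ ε

  moveToOrigin : ∀ x y → ∃ λ y′ → (x , y) ∼ (origin , y′)
  moveToOrigin (0F , a , b) y = moveToOrigin₀ a b y
  moveToOrigin (1F , a , b) y = -, (swap₀₁ , refl , refl) ◅ proj₂ (moveToOrigin₀ a b _)
  moveToOrigin (2F , a , b) y = -, (swap₁₂ , refl , refl) ◅ (swap₀₁ , refl , refl) ◅ proj₂ (moveToOrigin₀ a b _)

  meetInPart₁ : ∀ j → (origin , (0F , 0F , suc j)) ∼ (origin , representative 1F)
  meetInPart₁ j = (relabel id id (transpose (suc j) 1F) , refl , cong (λ b → 0F , 0F , b) (transpose-maps (suc j) 1F)) ◅ ε

  parallel : ∀ i j → (origin , (0F , suc i , suc j)) ∼ (origin , representative 2F)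
  parallel i j = (relabel id (transpose (suc i) 1F) (transpose (suc j) 1F) , refl ,
                  cong₂ (λ a b → 0F , a , b) (transpose-maps (suc i) 1F) (transpose-maps (suc j) 1F)) ◅ ε

  meetInPart₂ : ∀ a → (origin , (1F , a , 0F)) ∼ (origin , representative 3F)
  meetInPart₂ a = (relabel (transpose a 0F) id id , refl , cong (λ a′ → 1F , a′ , 0F) (transpose-maps a 0F)) ◅ ε

  skew : ∀ a j → (origin , (1F , a , suc j)) ∼ (origin , representative 4F)
  skew a j = (relabel (transpose a 0F) id (transpose (suc j) 1F) , refl ,
              cong₂ (λ a′ b → 1F , a′ , b) (transpose-maps a 0F) (transpose-maps (suc j) 1F)) ◅ ε

  -- Relabellings fixing vertex 0 of parts 1 and 2, and swap₁₂, fix origin.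
  fixOrigin : ∀ h y → R h origin y → (origin , y) ∼ (origin , representative h)
  fixOrigin 0F _ refl = ε
  fixOrigin 1F (_ , 0F , 0F) (o≢y , refl , _) = ⊥-elim (o≢y refl)
  fixOrigin 1F (_ , 0F , suc j) (_ , refl , _) = meetInPart₁ j
  fixOrigin 1F (_ , suc i , 0F) (_ , refl , _) = (swap₁₂ , refl , refl) ◅ meetInPart₁ i
  fixOrigin 1F (_ , suc i , suc j) (_ , refl , sh) = ⊥-elim (from-no (share? origin (0F , suc i , suc j)) sh)
  fixOrigin 2F (_ , 0F , _) (refl , ¬sh) = ⊥-elim (¬sh (-, inj₁ refl , inj₁ refl))
  fixOrigin 2F (_ , suc i , 0F) (refl , ¬sh) = ⊥-elim (¬sh (-, inj₂ refl , inj₂ refl))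
  fixOrigin 2F (_ , suc i , suc j) (refl , _) = parallel i j
  fixOrigin 3F (0F , _) (¬sp , _) = ⊥-elim (¬sp refl)
  fixOrigin 3F (1F , a , 0F) _ = meetInPart₂ a
  fixOrigin 3F (1F , a , suc j) (_ , sh) = ⊥-elim (from-no (share? origin (1F , a , suc j)) sh)
  fixOrigin 3F (2F , a , 0F) _ = (swap₁₂ , refl , refl) ◅ meetInPart₂ a
  fixOrigin 3F (2F , a , suc j) (_ , sh) = ⊥-elim (from-no (share? origin (2F , a , suc j)) sh)
  fixOrigin 4F (0F , _) (¬sp , _) = ⊥-elim (¬sp refl)
  fixOrigin 4F (1F , a , 0F) (_ , ¬sh) = ⊥-elim (¬sh (-, inj₂ refl , inj₂ refl))
  fixOrigin 4F (1F , a , suc j) _ = skew a j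
  fixOrigin 4F (2F , a , 0F) (_ , ¬sh) = ⊥-elim (¬sh (-, inj₁ refl , inj₂ refl))
  fixOrigin 4F (2F , a , suc j) _ = (swap₁₂ , refl , refl) ◅ skew a j

  orbitRepresentatives : OrbitRepresentatives (λ h → origin , representative h)
  orbitRepresentatives h x y r with moveToOrigin x y
  ... | y′ , x↦origin = x↦origin ◅◅ fixOrigin h y′ (∼-preserves-R x↦origin r)

proposition4p3 : (n : ℕ) → n ≥ 2 → IsSymAssocScheme (allEdges n) 4 R R?
proposition4p3 n (s≤s (s≤s _)) = record
  { partition = λ x y → relation x y , R-relation x y , λ j r → sym (R⇒relation j r)
  ; nonempty = λ h → origin , representative h , R-representative h
  ; identity = λ x y → ⇔-id (x ≡ y)
  ; symmetric = R-symmetric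
  ; intersection = EdgeScheme.intersectionNumbers n _ orbitRepresentatives
  }
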